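{- For every integer $g\ge 3$, there exists an oriented graph whose underlying graph is a bipartite cactus graph (i.e., a $K_4^-$-minor-free graph) with girth at least $g$, and whose oriented chromatic number is at least $5$.
   Context: An oriented graph is a graph each of whose edges is oriented (no two arcs on the same pair of vertices). A homomorphism of oriented graphs maps arcs to arcs preserving orientation. The oriented chromatic number of an oriented graph $G$ is the minimum number of vertices of an oriented graph $H$ such that $G$ admits a homomorphism to $H$. $K_4^-$ denotes $K_4$ minus an edge; a cactus graph is a graph in which every edge lies on at most one cycle, equivalently a $K_4^-$-minor-free graph. -}

module Defs where

open import Data.Nat using (ℕ; zero; suc; _≤_)
open import Data.Fin using (Fin; zero; suc; inject₁; fromℕ)
open import Data.Bool using (Bool)
open import Data.Product using (Σ; Σ-syntax; ∃; ∃-syntax; _×_; _,_)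
open import Data.Sum using (_⊎_)
open import Relation.Nullary using (¬_)
open import Relation.Binary.PropositionalEquality using (_≡_)
open import Function.Definitions using (Injective)

record OrientedGraph : Set₁ where
  field
    n      : ℕ
    Arc    : Fin n → Fin n → Set
    irrefl : ∀ u → ¬ Arc u u
    asym   : ∀ u v → Arc u v → ¬ Arc v u

open OrientedGraph public

Adj : (G : OrientedGraph) → Fin (n G) → Fin (n G) → Set
Adj G u v = Arc G u v ⊎ Arc G v u

Hom : OrientedGraph → OrientedGraph → Set
Hom G H = Σ (Fin (n G) → Fin (n H)) λ f → ∀ u v → Arc G u v → Arc H (f u) (f v)

OrientedChromaticAtLeast : OrientedGraph → ℕ → Set₁
OrientedChromaticAtLeast G k = (H : OrientedGraph) → Hom G H → k ≤ n H

Bipartite : OrientedGraph → Set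
Bipartite G = Σ (Fin (n G) → Bool) λ c → ∀ u v → Adj G u v → ¬ (c u ≡ c v)

record Cycle (G : OrientedGraph) : Set where
  field
    m       : ℕ
    long    : 3 ≤ suc m
    vtx     : Fin (suc m) → Fin (n G)
    inj     : Injective _≡_ _≡_ vtx
    step    : ∀ (i : Fin m) → Adj G (vtx (inject₁ i)) (vtx (suc i))
    closing : Adj G (vtx (fromℕ m)) (vtx zero)

open Cycle public

cycleLength : {G : OrientedGraph} → Cycle G → ℕ
cycleLength c = suc (m c)

Step : {G : OrientedGraph} → Cycle G → Fin (n G) → Fin (n G) → Set
Step c x y =
  (Σ[ i ∈ Fin (m c) ] (x ≡ vtx c (inject₁ i) × y ≡ vtx c (suc i)))
  ⊎ (x ≡ vtx c (fromℕ (m c)) × y ≡ vtx c zero)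

EdgeOn : {G : OrientedGraph} → Cycle G → Fin (n G) → Fin (n G) → Set
EdgeOn c x y = Step c x y ⊎ Step c y x

-- Two cycles are the same subgraph iff they have the same edge set.
SameCycle : {G : OrientedGraph} → Cycle G → Cycle G → Set
SameCycle {G} c c' = ∀ (a b : Fin (n G)) → (EdgeOn c a b → EdgeOn c' a b) × (EdgeOn c' a b → EdgeOn c a b)

Cactus : OrientedGraph → Set
Cactus G = ∀ (c c' : Cycle G) (x y : Fin (n G)) → Adj G x y →
  EdgeOn c x y → EdgeOn c' x y → SameCycle c c'

-- Girth at least g (vacuous for forests, whose girth is ∞).
GirthAtLeast : OrientedGraph → ℕ → Set
GirthAtLeast G g = ∀ (c : Cycle G) → g ≤ cycleLength c

-- The graph is a flower: three cycles ("petals") of length N = 4 + 6t glued at a hub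
-- vertex. It is bipartite because N is even, and every cycle of it is one of the petals,
-- so it is a cactus of girth N. Each petal is oriented by a word prefix · loopᵗ · suffix
-- over {forward, backward}. A homomorphism into an oriented graph on at most four
-- vertices induces an orientation-respecting colouring by a tournament on Fin 4, under
-- which every petal becomes a closed walk from the colour of the hub spelling its word.
-- For each of the 64 tournaments and each start colour s, one of the three words admits
-- no such walk: the set C of colours reachable from s after the prefix and one loop is
-- closed under the loop, and the suffix cannot lead from C back to s.

module Submission where

open import Defs
open import Data.Bool using (Bool; true; false; not; _∧_; if_then_else_; T)
open import Data.Bool.ListAction using (any)
open import Data.Bool.Properties using (T-≡; T-∧)
open import Data.Empty using (⊥; ⊥-elim)
open import Data.Fin using (Fin; zero; suc; toℕ; fromℕ<; fromℕ; inject₁; inject≤; combine)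
open import Data.Fin.Patterns using (0F; 1F; 2F; 3F)
open import Data.Fin.Properties
  using (any?; all?; toℕ-injective; toℕ-fromℕ<; toℕ<n; toℕ-fromℕ; toℕ-inject₁; toℕ-combine; combine-injective;
         inject≤-injective)
  renaming (_≟_ to _≟ᶠ_)
open import Data.Fin.Subset using (Subset; _∈_; _∉_; _⊆_; ⁅_⁆)
open import Data.Fin.Subset.Properties using (_∈?_; _⊆?_; x∈⁅x⁆)
open import Data.List using (List; []; _∷_; _++_; length; concat; replicate; allFin)
open import Data.List.Membership.Propositional using (lose)
open import Data.List.Membership.Propositional.Properties using (∈-allFin)
open import Data.List.Relation.Unary.Any using (satisfied)
open import Data.List.Relation.Unary.Any.Properties using (any⁺; any⁻)
open import Data.List.Properties using (length-++)
open import Data.Nat using (ℕ; zero; suc; pred; _+_; _*_; _∸_; _≤_; _<_; z≤n; s≤s; _<?_; _≤?_; _≟_; NonZero; parity)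
open import Data.Nat.Divisibility using (∣-refl)
open import Data.Nat.DivMod
  using (_%_; _mod_; m%n<n; m%n%n≡m%n; m<n⇒m%n≡m; n%n≡0; %-distribˡ-+; %-remove-+ˡ; [m+kn]%n≡m%n; m≤n⇒[n∸m]%m≡n%m)
open import Data.Nat.Properties
open import Data.Parity.Base using (Parity; 0ℙ; 1ℙ; _⁻¹)
import Data.Parity.Base as ℙ
open import Data.Parity.Properties using (+-homo-+; *-homo-*; suc-homo-⁻¹; p≢p⁻¹; ⁻¹-involutive)
  renaming (*-zeroʳ to ℙ-*-zeroʳ)
open import Data.Product using (Σ; ∃; ∃₂; _×_; _,_; proj₁; proj₂)
open import Data.Sum using (_⊎_; inj₁; inj₂)
open import Data.Unit using (⊤)
open import Data.Vec using (tabulate; lookup)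
open import Data.Vec.Properties using (lookup⇒[]=; []=⇒lookup; lookup∘tabulate)
open import Function using (_∘_; id; _⇔_; mk⇔; Equivalence)
open import Function.Definitions using (Injective)
open import Relation.Binary.Definitions using (tri<; tri≈; tri>)
open import Relation.Binary.PropositionalEquality
  using (_≡_; _≢_; refl; sym; trans; cong; subst; subst₂; module ≡-Reasoning)
open import Relation.Nullary using (¬_; ¬?; Dec; yes; no; contradiction)
import Relation.Nullary.Decidable as Dec
open import Relation.Nullary.Decidable
  using (isYes; _×-dec_; toWitness; fromWitness; fromWitnessFalse; True; False)

-- Walks spelling a word of directions, and the sets they can reach

∈⇒T-lookup : ∀ {n} {S : Subset n} {x} → x ∈ S → T (lookup S x)
∈⇒T-lookup x∈S = Equivalence.from T-≡ ([]=⇒lookup x∈S)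

T-lookup⇒∈ : ∀ {n} {S : Subset n} {x} → T (lookup S x) → x ∈ S
T-lookup⇒∈ {S = S} {x} t = lookup⇒[]= x S (Equivalence.to T-≡ t)

-- Positions past the end of the word read as false.
bitAt : List Bool → ℕ → Bool
bitAt []      _       = false
bitAt (b ∷ w) zero    = b
bitAt (b ∷ w) (suc d) = bitAt w d

module _ {n : ℕ} (R : Fin n → Fin n → Bool) where

  Along : Bool → Fin n → Fin n → Bool
  Along true  x y = R x y
  Along false x y = R y x

  IsWalk : (ℕ → Fin n) → List Bool → Set
  IsWalk F []      = ⊤
  IsWalk F (d ∷ w) = T (Along d (F 0) (F 1)) × IsWalk (F ∘ suc) w

  IsWalk-bitAt : ∀ w (F : ℕ → Fin n) → (∀ {d} → d < length w → T (Along (bitAt w d) (F d) (F (suc d)))) → IsWalk F w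
  IsWalk-bitAt []      F _    = _
  IsWalk-bitAt (b ∷ w) F step = step (s≤s z≤n) , IsWalk-bitAt w (F ∘ suc) (step ∘ s≤s)

  next : Bool → Subset n → Subset n
  next d S = tabulate λ y → any (λ x → lookup S x ∧ Along d x y) (allFin n)

  reach : Subset n → List Bool → Subset n
  reach S []      = S
  reach S (d ∷ w) = reach (next d S) w

  ∈-next⁺ : ∀ d {S x y} → x ∈ S → T (Along d x y) → y ∈ next d S
  ∈-next⁺ d {S} {x} {y} x∈S along = T-lookup⇒∈ (subst T (sym (lookup∘tabulate _ y))
    (any⁺ _ (lose (∈-allFin x) (Equivalence.from T-∧ (∈⇒T-lookup x∈S , along)))))

  ∈-next⁻ : ∀ d {S y} → y ∈ next d S → ∃ λ x → x ∈ S × T (Along d x y)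
  ∈-next⁻ d {S} {y} y∈next =
    let (x , both)   = satisfied (any⁻ _ (allFin n) (subst T (lookup∘tabulate _ y) (∈⇒T-lookup y∈next)))
        (x∈S , along) = Equivalence.to T-∧ both
    in x , T-lookup⇒∈ x∈S , along

  next-mono : ∀ d {S S'} → S ⊆ S' → next d S ⊆ next d S'
  next-mono d S⊆S' y∈next with ∈-next⁻ d y∈next
  ... | x , x∈S , step = ∈-next⁺ d (S⊆S' x∈S) step

  reach-mono : ∀ w {S S'} → S ⊆ S' → reach S w ⊆ reach S' w
  reach-mono []      S⊆S' = S⊆S'
  reach-mono (d ∷ w) S⊆S' = reach-mono w (next-mono d S⊆S')

  reach-++ : ∀ S u v → reach S (u ++ v) ≡ reach (reach S u) v
  reach-++ S []      v = refl
  reach-++ S (d ∷ u) v = reach-++ (next d S) u v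

  reach-replicate : ∀ {C} u → reach C u ⊆ C → ∀ k → reach C (concat (replicate k u)) ⊆ C
  reach-replicate u closed zero                = λ x∈C → x∈C
  reach-replicate {C} u closed (suc k) {x} x∈ =
    reach-replicate u closed k (reach-mono (concat (replicate k u)) closed
      (subst (x ∈_) (reach-++ C u _) x∈))

  reach-sound : ∀ {S} w (F : ℕ → Fin n) → F 0 ∈ S → IsWalk F w → F (length w) ∈ reach S w
  reach-sound []      F F0∈S _             = F0∈S
  reach-sound (d ∷ w) F F0∈S (step , walk) = reach-sound w (F ∘ suc) (∈-next⁺ d F0∈S step) walk

record PetalWord : Set where
  constructor petalWord
  field
    prefix loop suffix : List Bool

open PetalWord

word : PetalWord → ℕ → List Bool
word p k = prefix p ++ (concat (replicate k (loop p)) ++ suffix p)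

length-concat-replicate : ∀ {A : Set} k (u : List A) → length (concat (replicate k u)) ≡ k * length u
length-concat-replicate zero    u = refl
length-concat-replicate (suc k) u = trans (length-++ u) (cong (length u +_) (length-concat-replicate k u))

length-word : ∀ p k → length (word p k) ≡ length (prefix p) + (k * length (loop p) + length (suffix p))
length-word p k = trans (length-++ (prefix p)) (cong (length (prefix p) +_)
  (trans (length-++ (concat (replicate k (loop p)))) (cong (_+ length (suffix p)) (length-concat-replicate k (loop p)))))

module _ {n : ℕ} (R : Fin n → Fin n → Bool) where

  loopReach : Fin n → PetalWord → Subset n
  loopReach s p = reach R (reach R ⁅ s ⁆ (prefix p)) (loop p)

  Blocks : Fin n → PetalWord → Set
  Blocks s p = reach R (loopReach s p) (loop p) ⊆ loopReach s p × s ∉ reach R (loopReach s p) (suffix p)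

  blocks? : ∀ s p → Dec (Blocks s p)
  blocks? s p = (reach R (loopReach s p) (loop p) ⊆? loopReach s p) ×-dec ¬? (s ∈? reach R (loopReach s p) (suffix p))

  blocks⇒unreachable : ∀ {s p} → Blocks s p → ∀ k → s ∉ reach R ⁅ s ⁆ (word p (suc k))
  blocks⇒unreachable {s} {p} (closed , s∉) k s∈ =
    s∉ (reach-mono R (suffix p) (reach-replicate R (loop p) closed k) (subst (s ∈_) eq s∈))
    where
    pre u rest : List Bool
    pre  = prefix p
    u    = loop p
    rest = concat (replicate k u)
    eq : reach R ⁅ s ⁆ (word p (suc k)) ≡ reach R (reach R (loopReach s p) rest) (suffix p)
    eq = begin
      reach R ⁅ s ⁆ (pre ++ ((u ++ rest) ++ suffix p))     ≡⟨ reach-++ R ⁅ s ⁆ pre _ ⟩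
      reach R (reach R ⁅ s ⁆ pre) ((u ++ rest) ++ suffix p) ≡⟨ reach-++ R _ (u ++ rest) (suffix p) ⟩
      reach R (reach R (reach R ⁅ s ⁆ pre) (u ++ rest)) (suffix p)
        ≡⟨ cong (λ S → reach R S (suffix p)) (reach-++ R _ u rest) ⟩
      reach R (reach R (loopReach s p) rest) (suffix p) ∎
      where open ≡-Reasoning

  blocks⇒no-closed-walk : ∀ {s p} → Blocks s p → ∀ k (F : ℕ → Fin n) → IsWalk R F (word p (suc k)) →
                          F 0 ≡ s → F (length (word p (suc k))) ≢ s
  blocks⇒no-closed-walk {s} {p} blocks k F walk refl end =
    blocks⇒unreachable {s} {p} blocks k (subst (_∈ reach R ⁅ s ⁆ (word p (suc k))) end
      (reach-sound R (word p (suc k)) F (x∈⁅x⁆ s) walk))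

-- Tournaments on four vertices

data Tournament4 : Set where
  tournament4 : (b₀₁ b₀₂ b₀₃ b₁₂ b₁₃ b₂₃ : Bool) → Tournament4

beats : Tournament4 → Fin 4 → Fin 4 → Bool
beats (tournament4 b₀₁ b₀₂ b₀₃ b₁₂ b₁₃ b₂₃) = λ where
  0F 0F → false
  0F 1F → b₀₁
  0F 2F → b₀₂
  0F 3F → b₀₃
  1F 0F → not b₀₁
  1F 1F → false
  1F 2F → b₁₂
  1F 3F → b₁₃
  2F 0F → not b₀₂
  2F 1F → not b₁₂
  2F 2F → false
  2F 3F → b₂₃
  3F 0F → not b₀₃
  3F 1F → not b₁₃
  3F 2F → not b₂₃
  3F 3F → false

tournament-extending : {E : Fin 4 → Fin 4 → Set} → (∀ a b → Dec (E a b)) →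
                       (∀ a → ¬ E a a) → (∀ {a b} → E a b → ¬ E b a) →
                       ∃ λ tour → ∀ {a b} → E a b → T (beats tour a b)
tournament-extending {E} E? E-irrefl E-asym = tour , extends
  where
  tour : Tournament4
  tour = tournament4 (isYes (E? 0F 1F)) (isYes (E? 0F 2F)) (isYes (E? 0F 3F))
                     (isYes (E? 1F 2F)) (isYes (E? 1F 3F)) (isYes (E? 2F 3F))
  forward : ∀ {a b} → E a b → True (E? a b)
  forward = fromWitness
  backward : ∀ {a b} → E b a → False (E? a b)
  backward e = fromWitnessFalse (E-asym e)
  extends : ∀ {a b} → E a b → T (beats tour a b)
  extends {0F} {0F} e = E-irrefl 0F e
  extends {0F} {1F} e = forward e
  extends {0F} {2F} e = forward e
  extends {0F} {3F} e = forward e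
  extends {1F} {0F} e = backward e
  extends {1F} {1F} e = E-irrefl 1F e
  extends {1F} {2F} e = forward e
  extends {1F} {3F} e = forward e
  extends {2F} {0F} e = backward e
  extends {2F} {1F} e = backward e
  extends {2F} {2F} e = E-irrefl 2F e
  extends {2F} {3F} e = forward e
  extends {3F} {0F} e = backward e
  extends {3F} {1F} e = backward e
  extends {3F} {2F} e = backward e
  extends {3F} {3F} e = E-irrefl 3F e

∀-Bool? : {P : Bool → Set} → (∀ b → Dec (P b)) → Dec (∀ b → P b)
∀-Bool? P? = Dec.map′ (λ (t , f) → λ { true → t ; false → f }) (λ h → h true , h false) (P? true ×-dec P? false)

∀-Tournament4? : {P : Tournament4 → Set} → (∀ tour → Dec (P tour)) → Dec (∀ tour → P tour)
∀-Tournament4? P? =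
  Dec.map′ (λ h → λ { (tournament4 b₀₁ b₀₂ b₀₃ b₁₂ b₁₃ b₂₃) → h b₀₁ b₀₂ b₀₃ b₁₂ b₁₃ b₂₃ })
           (λ h b₀₁ b₀₂ b₀₃ b₁₂ b₁₃ b₂₃ → h (tournament4 b₀₁ b₀₂ b₀₃ b₁₂ b₁₃ b₂₃))
           (∀-Bool? λ b₀₁ → ∀-Bool? λ b₀₂ → ∀-Bool? λ b₀₃ → ∀-Bool? λ b₁₂ → ∀-Bool? λ b₁₃ → ∀-Bool? λ b₂₃ →
              P? (tournament4 b₀₁ b₀₂ b₀₃ b₁₂ b₁₃ b₂₃))

petals : Fin 3 → PetalWord
petals 0F = petalWord (true ∷ true ∷ true ∷ true ∷ []) (true ∷ true ∷ true ∷ true ∷ true ∷ true ∷ []) []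
petals 1F = petalWord (true ∷ true ∷ false ∷ true ∷ []) (false ∷ true ∷ false ∷ true ∷ false ∷ true ∷ []) []
petals 2F = petalWord [] (true ∷ false ∷ true ∷ false ∷ true ∷ false ∷ []) (true ∷ false ∷ true ∷ true ∷ [])

-- Decided by evaluation over all 64 tournaments; opaque so that type checking never
-- unfolds it at a symbolic tournament.
opaque
  some-petal-blocks : ∀ tour s → ∃ λ j → Blocks (beats tour) s (petals j)
  some-petal-blocks = toWitness {a? = ∀-Tournament4? λ tour → all? λ s → any? λ j → blocks? (beats tour) s (petals j)} _

hom-to-4-extends-to-tournament : (G H : OrientedGraph) → (∀ u v → Dec (Arc G u v)) →
                                 (hom : Hom G H) → (n≤4 : n H ≤ 4) →
  let colour = λ u → inject≤ (proj₁ hom u) n≤4 in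
  ∃ λ tour → ∀ {u v} → Arc G u v → T (beats tour (colour u) (colour v))
hom-to-4-extends-to-tournament G H Arc? (f , preserves) n≤4 =
  let (tour , extends) = tournament-extending E? E-irrefl E-asym in tour , λ arc → extends (_ , _ , arc , refl , refl)
  where
  colour : Fin (n G) → Fin 4
  colour u = inject≤ (f u) n≤4

  colour-injective : ∀ {u v} → colour u ≡ colour v → f u ≡ f v
  colour-injective = inject≤-injective n≤4 n≤4 _ _

  E : Fin 4 → Fin 4 → Set
  E a b = ∃₂ λ u v → Arc G u v × colour u ≡ a × colour v ≡ b

  E? : ∀ a b → Dec (E a b)
  E? a b = any? λ u → any? λ v → Arc? u v ×-dec (colour u ≟ᶠ a) ×-dec (colour v ≟ᶠ b)

  E-irrefl : ∀ a → ¬ E a a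
  E-irrefl a (u , v , arc , refl , eq) = irrefl H (f u) (subst (Arc H (f u)) (colour-injective eq) (preserves u v arc))

  E-asym : ∀ {a b} → E a b → ¬ E b a
  E-asym (u , v , arc , refl , refl) (u' , v' , arc' , eq₀ , eq₁) =
    asym H (f u) (f v) (preserves u v arc) (subst₂ (Arc H) (colour-injective eq₀) (colour-injective eq₁) (preserves u' v' arc'))

-- Cycles as periodic walks

SamePair : {A : Set} → A → A → A → A → Set
SamePair a b x y = (a ≡ x × b ≡ y) ⊎ (a ≡ y × b ≡ x)

SamePair-flip : {A : Set} {a b x y : A} → SamePair a b x y → SamePair a b y x
SamePair-flip (inj₁ (a≡x , b≡y)) = inj₂ (a≡x , b≡y)
SamePair-flip (inj₂ (a≡y , b≡x)) = inj₁ (a≡y , b≡x)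

SamePair-map : {A B : Set} (f : A → B) {a b x y : A} → SamePair a b x y → SamePair (f a) (f b) (f x) (f y)
SamePair-map f (inj₁ (refl , refl)) = inj₁ (refl , refl)
SamePair-map f (inj₂ (refl , refl)) = inj₂ (refl , refl)

SamePair-unmap : {A B : Set} {f : A → B} → Injective _≡_ _≡_ f →
                 {a b x y : A} → SamePair (f a) (f b) (f x) (f y) → SamePair a b x y
SamePair-unmap f-inj (inj₁ (eq₀ , eq₁)) = inj₁ (f-inj eq₀ , f-inj eq₁)
SamePair-unmap f-inj (inj₂ (eq₀ , eq₁)) = inj₂ (f-inj eq₀ , f-inj eq₁)

SamePair-swap : {A : Set} {a b x y : A} → SamePair a b x y → SamePair b a x y
SamePair-swap (inj₁ (a≡x , b≡y)) = inj₂ (b≡y , a≡x)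
SamePair-swap (inj₂ (a≡y , b≡x)) = inj₁ (b≡x , a≡y)

[d+m]%n≢m : ∀ {d m n} .{{_ : NonZero n}} → m < n → 0 < d → d < n → (d + m) % n ≢ m
[d+m]%n≢m {d} {m} {n} m<n 0<d d<n eq with d + m <? n
... | yes d+m<n = <-irrefl (sym (trans (sym (m<n⇒m%n≡m d+m<n)) eq)) (m<n+m m 0<d)
-- Otherwise (d + m) % n is d + m ∸ n, which is m only if d = n.
... | no  d+m≮n = <-irrefl (+-cancelʳ-≡ m d n (trans (sym (m∸n+n≡m n≤d+m)) (trans (cong (_+ n) wrapped) (+-comm m n)))) d<n
  where
  n≤d+m : n ≤ d + m
  n≤d+m = ≮⇒≥ d+m≮n
  wrapped : d + m ∸ n ≡ m
  wrapped = trans (sym (m<n⇒m%n≡m (subst (d + m ∸ n <_) (m+n∸n≡m n n) (∸-monoˡ-< (+-mono-< d<n m<n) n≤d+m))))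
                  (trans (m≤n⇒[n∸m]%m≡n%m n≤d+m) eq)

[d+m]%n≢m%n : ∀ d m {n} .{{_ : NonZero n}} → 0 < d → d < n → (d + m) % n ≢ m % n
[d+m]%n≢m%n d m {n} 0<d d<n eq = [d+m]%n≢m (m%n<n m n) 0<d d<n (begin
  (d + m % n) % n       ≡⟨ cong (λ x → (x + m % n) % n) (sym (m<n⇒m%n≡m d<n)) ⟩
  (d % n + m % n) % n   ≡⟨ sym (%-distribˡ-+ d m n) ⟩
  (d + m) % n           ≡⟨ eq ⟩
  m % n                 ∎)
  where open ≡-Reasoning

%-cong-+ˡ : ∀ k {m o n} .{{_ : NonZero n}} → m % n ≡ o % n → (k + m) % n ≡ (k + o) % n
%-cong-+ˡ k {m} {o} {n} eq = begin
  (k + m) % n           ≡⟨ %-distribˡ-+ k m n ⟩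
  (k % n + m % n) % n   ≡⟨ cong (λ x → (k % n + x) % n) eq ⟩
  (k % n + o % n) % n   ≡⟨ sym (%-distribˡ-+ k o n) ⟩
  (k + o) % n           ∎
  where open ≡-Reasoning

module CycleWalk {G : OrientedGraph} (c : Cycle G) where

  L : ℕ
  L = cycleLength c

  walk : ℕ → Fin (n G)
  walk i = vtx c (i mod L)

  walk-% : ∀ i j → i % L ≡ j % L → walk i ≡ walk j
  walk-% i j eq = cong (vtx c) (toℕ-injective (trans (toℕ-fromℕ< _) (trans eq (sym (toℕ-fromℕ< _)))))

  walk-index : ∀ (r : Fin L) → walk (toℕ r) ≡ vtx c r
  walk-index r = cong (vtx c) (toℕ-injective (trans (toℕ-fromℕ< _) (m<n⇒m%n≡m (toℕ<n r))))

  walk-L : walk L ≡ vtx c zero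
  walk-L = walk-% L 0 (n%n≡0 L)

  walk-periodic : ∀ i → walk (L + i) ≡ walk i
  walk-periodic i = walk-% (L + i) i (%-remove-+ˡ i (∣-refl {L}))

  walk-injective : ∀ i {d} → 0 < d → d < L → walk (d + i) ≢ walk i
  walk-injective i {d} 0<d d<L eq =
    [d+m]%n≢m%n d i 0<d d<L (trans (sym (toℕ-fromℕ< _)) (trans (cong toℕ (inj c eq)) (toℕ-fromℕ< _)))

  step-from : ∀ (r : Fin L) → Step c (vtx c r) (walk (suc (toℕ r)))
  step-from r with toℕ r <? m c
  ... | yes r<m = inj₁ (k , cong (vtx c) (toℕ-injective (sym (trans (toℕ-inject₁ k) (toℕ-fromℕ< r<m)))) ,
                            trans (cong (walk ∘ suc) (sym (toℕ-fromℕ< r<m))) (walk-index (suc k)))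
    where
    k : Fin (m c)
    k = fromℕ< r<m
  ... | no  r≮m = inj₂ (cong (vtx c) (toℕ-injective (trans r≡m (sym (toℕ-fromℕ (m c))))) ,
                        trans (cong (walk ∘ suc) r≡m) walk-L)
    where
    r≡m : toℕ r ≡ m c
    r≡m = ≤-antisym (≤-pred (toℕ<n r)) (≮⇒≥ r≮m)

  walk-step : ∀ i → Step c (walk i) (walk (suc i))
  walk-step i = subst (Step c (walk i)) (walk-% (suc (toℕ (i mod L))) (suc i) suc-mod) (step-from (i mod L))
    where
    suc-mod : suc (toℕ (i mod L)) % L ≡ suc i % L
    suc-mod = trans (cong (λ r → suc r % L) (toℕ-fromℕ< (m%n<n i L))) (%-cong-+ˡ 1 {i % L} {i} {L} (m%n%n≡m%n i L))

  walk-adj : ∀ i → Adj G (walk i) (walk (suc i))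
  walk-adj i with walk-step i
  ... | inj₁ (k , eq₀ , eq₁) = subst₂ (Adj G) (sym eq₀) (sym eq₁) (step c k)
  ... | inj₂ (eq₀ , eq₁)     = subst₂ (Adj G) (sym eq₀) (sym eq₁) (closing c)

  step⇒walk-step : ∀ {a b} → Step c a b → ∃ λ i → a ≡ walk i × b ≡ walk (suc i)
  step⇒walk-step (inj₁ (k , refl , refl)) =
    toℕ k , trans (sym (walk-index (inject₁ k))) (cong walk (toℕ-inject₁ k)) , sym (walk-index (suc k))
  step⇒walk-step (inj₂ (refl , refl)) =
    m c , trans (sym (walk-index (fromℕ (m c)))) (cong walk (toℕ-fromℕ (m c))) , sym walk-L

  edgeOn⇒walk-edge : ∀ {a b} → EdgeOn c a b → ∃ λ i → SamePair a b (walk i) (walk (suc i))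
  edgeOn⇒walk-edge (inj₁ step) = let (i , a≡ , b≡) = step⇒walk-step step in i , inj₁ (a≡ , b≡)
  edgeOn⇒walk-edge (inj₂ step) = let (i , b≡ , a≡) = step⇒walk-step step in i , inj₂ (a≡ , b≡)

  walk-edge⇒edgeOn : ∀ {a b} i → SamePair a b (walk i) (walk (suc i)) → EdgeOn c a b
  walk-edge⇒edgeOn i (inj₁ (refl , refl)) = inj₁ (walk-step i)
  walk-edge⇒edgeOn i (inj₂ (refl , refl)) = inj₂ (walk-step i)

  walk-rotate : ∀ h i → ∃ λ d → d < L × walk i ≡ walk (d + h) × walk (suc i) ≡ walk (suc d + h)
  walk-rotate h i = y % L , m%n<n y L , walk-% i (y % L + h) (sym rotated) ,
                    walk-% (suc i) (suc (y % L + h)) (%-cong-+ˡ 1 {i} {y % L + h} {L} (sym rotated))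
    where
    y : ℕ
    y = i + h * L ∸ h
    rotated : (y % L + h) % L ≡ i % L
    rotated = begin
      (y % L + h) % L ≡⟨ cong (_% L) (+-comm (y % L) h) ⟩
      (h + y % L) % L ≡⟨ %-cong-+ˡ h (m%n%n≡m%n y L) ⟩
      (h + y) % L     ≡⟨ cong (_% L) (m+[n∸m]≡n (≤-trans (m≤m*n h L) (m≤n+m (h * L) i))) ⟩
      (i + h * L) % L ≡⟨ [m+kn]%n≡m%n i h L ⟩
      i % L           ∎
      where open ≡-Reasoning

-- Flowers: petals of a common length N glued at a hub

module Flower (p N : ℕ) (3≤N : 3 ≤ N) (orient : Fin p → ℕ → Bool) where

  -- Position d of petal j, for 0 < d < N, is the vertex numbered N · j + d; positions 0
  -- and N are the hub 0. The numbers N · j with j > 0 are isolated vertices.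
  vertexAt : Fin p → ℕ → ℕ
  vertexAt j zero = 0
  vertexAt j (suc e) with suc e <? N
  ... | yes e<N = toℕ (combine j (fromℕ< e<N))
  ... | no  _   = 0

  0<N : 0 < N
  0<N = <-≤-trans (s≤s z≤n) 3≤N

  vertexAt-interior : ∀ j {d} → 0 < d → d < N → vertexAt j d ≡ N * toℕ j + d
  vertexAt-interior j {suc e} _ d<N with suc e <? N
  ... | yes e<N = trans (toℕ-combine j (fromℕ< e<N)) (cong (N * toℕ j +_) (toℕ-fromℕ< e<N))
  ... | no  d≮N = contradiction d<N d≮N

  vertexAt-interior≢0 : ∀ j {d} → 0 < d → d < N → vertexAt j d ≢ 0
  vertexAt-interior≢0 j {suc e} 0<d d<N eq =
    1+n≢0 (trans (sym (+-suc (N * toℕ j) e)) (trans (sym (vertexAt-interior j 0<d d<N)) eq))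

  vertexAt-≥N : ∀ j {d} → N ≤ d → vertexAt j d ≡ 0
  vertexAt-≥N j {zero}  _   = refl
  vertexAt-≥N j {suc e} N≤d with suc e <? N
  ... | yes d<N = contradiction N≤d (<⇒≱ d<N)
  ... | no  _   = refl

  vertexAt-injective : ∀ {j j' d d'} → 0 < d → d < N → 0 < d' → d' < N →
                       vertexAt j d ≡ vertexAt j' d' → j ≡ j' × d ≡ d'
  vertexAt-injective {j} {j'} {suc e} {suc e'} _ d<N _ d'<N eq with suc e <? N | suc e' <? N
  ... | no d≮N   | _          = contradiction d<N d≮N
  ... | yes _    | no d'≮N    = contradiction d'<N d'≮N
  ... | yes e<N  | yes e'<N   with combine-injective j _ j' _ (toℕ-injective eq)
  ...   | j≡j' , e≡e' = j≡j' , trans (sym (toℕ-fromℕ< e<N)) (trans (cong toℕ e≡e') (toℕ-fromℕ< e'<N))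

  vertexAt<pN : ∀ j d → vertexAt j d < p * N
  vertexAt<pN j zero = ≤-trans (s≤s z≤n) (toℕ<n (combine j (fromℕ< 0<N)))
  vertexAt<pN j (suc e) with suc e <? N
  ... | yes e<N = toℕ<n (combine j (fromℕ< e<N))
  ... | no  _   = vertexAt<pN j zero

  Position : ℕ → Set
  Position d = d ≡ 0 ⊎ d ≡ N ⊎ (0 < d × d < N)

  position : ∀ {d} → d ≤ N → Position d
  position {zero}  _   = inj₁ refl
  position {suc d} d≤N with m≤n⇒m<n∨m≡n d≤N
  ... | inj₁ d<N = inj₂ (inj₂ (s≤s z≤n , d<N))
  ... | inj₂ d≡N = inj₂ (inj₁ d≡N)

  vertexAt≢0⇒interior : ∀ j {d} → d ≤ N → vertexAt j d ≢ 0 → 0 < d × d < N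
  vertexAt≢0⇒interior j d≤N ≢0 with position d≤N
  ... | inj₁ refl         = contradiction refl ≢0
  ... | inj₂ (inj₁ refl)  = contradiction (vertexAt-≥N j ≤-refl) ≢0
  ... | inj₂ (inj₂ inner) = inner

  interior-vertexAt-injective : ∀ {j j' d d'} → 0 < d → d < N → d' ≤ N →
                                vertexAt j d ≡ vertexAt j' d' → j ≡ j' × d ≡ d'
  interior-vertexAt-injective {j} {j'} 0<d d<N d'≤N eq =
    let (0<d' , d'<N) = vertexAt≢0⇒interior j' d'≤N (λ z → vertexAt-interior≢0 j 0<d d<N (trans eq z))
    in vertexAt-injective 0<d d<N 0<d' d'<N eq

  vertexAt-distinct : ∀ j {e k} → 0 < k → k < N → k + e ≤ N → vertexAt j e ≢ vertexAt j (k + e)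
  vertexAt-distinct j {e} {k} 0<k k<N k+e≤N eq with position (≤-trans (m≤n+m e k) k+e≤N)
  ... | inj₁ refl =
    vertexAt-interior≢0 j 0<k k<N (sym (trans eq (cong (vertexAt j) (+-identityʳ k))))
  ... | inj₂ (inj₁ refl) =
    <-irrefl refl (<-≤-trans (m<n+m e 0<k) k+e≤N)
  ... | inj₂ (inj₂ (0<e , e<N)) =
    <-irrefl (proj₂ (interior-vertexAt-injective 0<e e<N k+e≤N eq)) (m<n+m e 0<k)

  1<N : 1 < N
  1<N = <-≤-trans (s≤s (s≤s z≤n)) 3≤N

  2<N : 2 < N
  2<N = 3≤N

  PetalEdge : Fin p → ℕ → ℕ → Set
  PetalEdge j a b = ∃ λ d → d < N × SamePair a b (vertexAt j d) (vertexAt j (suc d))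

  FlowerEdge : ℕ → ℕ → Set
  FlowerEdge a b = ∃ λ j → PetalEdge j a b

  FlowerEdge-sym : ∀ {a b} → FlowerEdge a b → FlowerEdge b a
  FlowerEdge-sym (j , d , d<N , pair) = j , d , d<N , SamePair-swap pair

  petal-step-injective : ∀ {j j' d d'} → d < N → d' < N → vertexAt j d ≡ vertexAt j' d' →
                         vertexAt j (suc d) ≡ vertexAt j' (suc d') → j ≡ j' × d ≡ d'
  petal-step-injective {d = zero}  _   d'<N _   eq₁ with interior-vertexAt-injective (s≤s z≤n) 1<N d'<N eq₁
  ... | j≡j' , 1≡1+d' = j≡j' , cong pred 1≡1+d'
  petal-step-injective {d = suc e} d<N d'<N eq₀ _   = interior-vertexAt-injective (s≤s z≤n) d<N (<⇒≤ d'<N) eq₀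

  petal-step-not-reversed : ∀ {j j' d d'} → d < N → d' < N → vertexAt j d ≡ vertexAt j' (suc d') →
                            vertexAt j (suc d) ≢ vertexAt j' d'
  petal-step-not-reversed {j} {d = zero}  _   d'<N eq₀ eq₁ with interior-vertexAt-injective (s≤s z≤n) 1<N (<⇒≤ d'<N) eq₁
  ... | refl , refl = vertexAt-distinct j {0} {2} (s≤s z≤n) 2<N (<⇒≤ 2<N) eq₀
  petal-step-not-reversed {j} {d = suc e} d<N d'<N eq₀ eq₁ with interior-vertexAt-injective (s≤s z≤n) d<N d'<N eq₀
  ... | refl , refl = vertexAt-distinct j {e} {2} (s≤s z≤n) 2<N d<N (sym eq₁)

  petal-edge-unique : ∀ {a b j j' d d'} → d < N → d' < N →
                      SamePair a b (vertexAt j d) (vertexAt j (suc d)) →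
                      SamePair a b (vertexAt j' d') (vertexAt j' (suc d')) → j ≡ j' × d ≡ d'
  petal-edge-unique d<N d'<N (inj₁ (refl , refl)) (inj₁ (eq₀ , eq₁)) = petal-step-injective d<N d'<N eq₀ eq₁
  petal-edge-unique d<N d'<N (inj₁ (refl , refl)) (inj₂ (eq₀ , eq₁)) = ⊥-elim (petal-step-not-reversed d<N d'<N eq₀ eq₁)
  petal-edge-unique d<N d'<N (inj₂ (refl , refl)) (inj₁ (eq₀ , eq₁)) =
    ⊥-elim (petal-step-not-reversed d'<N d<N (sym eq₀) (sym eq₁))
  petal-edge-unique d<N d'<N (inj₂ (refl , refl)) (inj₂ (eq₀ , eq₁)) = petal-step-injective d<N d'<N eq₁ eq₀

  interior-neighbours : ∀ j {a q} → 0 < q → q < N → FlowerEdge a (vertexAt j q) →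
                        a ≡ vertexAt j (pred q) ⊎ a ≡ vertexAt j (suc q)
  interior-neighbours j 0<q q<N (j' , d , d<N , inj₁ (a≡ , eq)) with interior-vertexAt-injective 0<q q<N d<N eq
  ... | refl , refl = inj₁ a≡
  interior-neighbours j 0<q q<N (j' , d , d<N , inj₂ (a≡ , eq)) with interior-vertexAt-injective 0<q q<N (<⇒≤ d<N) eq
  ... | refl , refl = inj₂ a≡

  arcTail arcHead : Fin p → ℕ → ℕ
  arcTail j d = if orient j d then vertexAt j d else vertexAt j (suc d)
  arcHead j d = if orient j d then vertexAt j (suc d) else vertexAt j d

  arcTail≢arcHead : ∀ j {d} → d < N → arcTail j d ≢ arcHead j d
  arcTail≢arcHead j {d} d<N with orient j d
  ... | true  = vertexAt-distinct j {d} {1} (s≤s z≤n) 1<N d<N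
  ... | false = vertexAt-distinct j {d} {1} (s≤s z≤n) 1<N d<N ∘ sym

  arc-ends : ∀ j d → SamePair (arcTail j d) (arcHead j d) (vertexAt j d) (vertexAt j (suc d))
  arc-ends j d with orient j d
  ... | true  = inj₁ (refl , refl)
  ... | false = inj₂ (refl , refl)

  FlowerArc : Fin (p * N) → Fin (p * N) → Set
  FlowerArc u v = ∃₂ λ j d → d < N × toℕ u ≡ arcTail j d × toℕ v ≡ arcHead j d

  arc-pair : ∀ {u v : Fin (p * N)} j d → toℕ u ≡ arcTail j d → toℕ v ≡ arcHead j d →
              SamePair (toℕ u) (toℕ v) (vertexAt j d) (vertexAt j (suc d))
  arc-pair j d u≡t v≡h = subst₂ (λ a b → SamePair a b _ _) (sym u≡t) (sym v≡h) (arc-ends j d)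

  arc⇒edge : ∀ {u v} → FlowerArc u v → FlowerEdge (toℕ u) (toℕ v)
  arc⇒edge (j , d , d<N , u≡t , v≡h) = j , d , d<N , arc-pair j d u≡t v≡h

  flower-irrefl : ∀ u → ¬ FlowerArc u u
  flower-irrefl u (j , d , d<N , u≡t , u≡h) = arcTail≢arcHead j d<N (trans (sym u≡t) u≡h)

  flower-asym : ∀ u v → FlowerArc u v → ¬ FlowerArc v u
  flower-asym u v (j , d , d<N , u≡t , v≡h) (j' , d' , d'<N , v≡t' , u≡h')
    with petal-edge-unique d<N d'<N (arc-pair j d u≡t v≡h) (SamePair-swap (arc-pair j' d' v≡t' u≡h'))
  ... | refl , refl = arcTail≢arcHead j d<N (trans (sym u≡t) u≡h')

  flower : OrientedGraph
  flower = record { n = p * N ; Arc = FlowerArc ; irrefl = flower-irrefl ; asym = flower-asym }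

  adj⇒edge : ∀ {u v} → Adj flower u v → FlowerEdge (toℕ u) (toℕ v)
  adj⇒edge (inj₁ arc) = arc⇒edge arc
  adj⇒edge (inj₂ arc) = FlowerEdge-sym (arc⇒edge arc)

  module _ (evenN : parity N ≡ 0ℙ) where

    parity-vertexAt : ∀ j {d} → d ≤ N → parity (vertexAt j d) ≡ parity d
    parity-vertexAt j {d} d≤N with position d≤N
    ... | inj₁ refl               = refl
    ... | inj₂ (inj₁ refl)        = trans (cong parity (vertexAt-≥N j ≤-refl)) (sym evenN)
    ... | inj₂ (inj₂ (0<d , d<N)) = begin
      parity (vertexAt j d)                      ≡⟨ cong parity (vertexAt-interior j 0<d d<N) ⟩
      parity (N * toℕ j + d)                     ≡⟨ +-homo-+ (N * toℕ j) d ⟩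
      parity (N * toℕ j) ℙ.+ parity d            ≡⟨ cong (ℙ._+ parity d) (*-homo-* N (toℕ j)) ⟩
      (parity N ℙ.* parity (toℕ j)) ℙ.+ parity d ≡⟨ cong (λ x → (x ℙ.* parity (toℕ j)) ℙ.+ parity d) evenN ⟩
      parity d                                   ∎
      where open ≡-Reasoning

    petal-step-parity : ∀ j {d} → d < N → parity (vertexAt j (suc d)) ≡ parity (vertexAt j d) ⁻¹
    petal-step-parity j {d} d<N = begin
      parity (vertexAt j (suc d)) ≡⟨ parity-vertexAt j d<N ⟩
      parity (suc d)              ≡⟨ sym (⁻¹-involutive (parity (suc d))) ⟩
      parity (suc d) ⁻¹ ⁻¹        ≡⟨ cong _⁻¹ (suc-homo-⁻¹ d) ⟩
      parity d ⁻¹                 ≡⟨ cong _⁻¹ (sym (parity-vertexAt j (<⇒≤ d<N))) ⟩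
      parity (vertexAt j d) ⁻¹    ∎
      where open ≡-Reasoning

    edge-parity : ∀ {a b} → FlowerEdge a b → parity a ≢ parity b
    edge-parity (j , d , d<N , inj₁ (refl , refl)) eq = p≢p⁻¹ _ (trans eq (petal-step-parity j d<N))
    edge-parity (j , d , d<N , inj₂ (refl , refl)) eq = p≢p⁻¹ _ (trans (sym eq) (petal-step-parity j d<N))

    flower-bipartite : Bipartite flower
    flower-bipartite = (λ v → isOdd (parity (toℕ v))) , λ u v adj eq → edge-parity (adj⇒edge adj) (isOdd-injective eq)
      where
      isOdd : Parity → Bool
      isOdd 0ℙ = false
      isOdd 1ℙ = true
      isOdd-injective : ∀ {x y} → isOdd x ≡ isOdd y → x ≡ y
      isOdd-injective {0ℙ} {0ℙ} _ = refl
      isOdd-injective {1ℙ} {1ℙ} _ = refl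

  -- ρ d is the vertex at distance d from the hub when petal `petal` is walked in one of
  -- its two directions.
  record Traversal : Set where
    field
      petal        : Fin p
      ρ            : ℕ → ℕ
      ρ-0          : ρ 0 ≡ 0
      ρ-N          : ρ N ≡ 0
      ρ-interior≢0 : ∀ {q} → 0 < q → q < N → ρ q ≢ 0
      ρ-neighbours : ∀ {a q} → 0 < q → q < N → FlowerEdge a (ρ q) → a ≡ ρ (pred q) ⊎ a ≡ ρ (suc q)
      ρ-edges      : ∀ {a b} → PetalEdge petal a b ⇔ (∃ λ d → d < N × SamePair a b (ρ d) (ρ (suc d)))

  forward : Fin p → Traversal
  forward j = record
    { petal        = j
    ; ρ            = vertexAt j
    ; ρ-0          = refl
    ; ρ-N          = vertexAt-≥N j ≤-refl
    ; ρ-interior≢0 = vertexAt-interior≢0 j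
    ; ρ-neighbours = interior-neighbours j
    ; ρ-edges      = mk⇔ id id
    }

  mirror-< : ∀ {d} → d < N → N ∸ suc d < N
  mirror-< d<N = ∸-monoʳ-< (s≤s z≤n) d<N

  suc-mirror : ∀ {d} → d < N → suc (N ∸ suc d) ≡ N ∸ d
  suc-mirror d<N = sym (+-∸-assoc 1 d<N)

  mirror-mirror : ∀ {d} → d < N → N ∸ (N ∸ suc d) ≡ suc d × N ∸ suc (N ∸ suc d) ≡ d
  mirror-mirror d<N = m∸[m∸n]≡n d<N , trans (cong (N ∸_) (suc-mirror d<N)) (m∸[m∸n]≡n (<⇒≤ d<N))

  backward : Fin p → Traversal
  backward j = record
    { petal        = j
    ; ρ            = ρ
    ; ρ-0          = vertexAt-≥N j ≤-refl
    ; ρ-N          = cong (vertexAt j) (n∸n≡0 N)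
    ; ρ-interior≢0 = λ 0<q q<N → vertexAt-interior≢0 j (m<n⇒0<n∸m q<N) (∸-monoʳ-< 0<q (<⇒≤ q<N))
    ; ρ-neighbours = neighbours
    ; ρ-edges      = mk⇔ (reflect {σ = ρ} λ d<N → let (e₁ , e₂) = mirror-mirror d<N
                                                in cong (vertexAt j) e₁ , cong (vertexAt j) e₂)
                         (reflect {σ = vertexAt j} λ d<N → refl , cong (vertexAt j) (suc-mirror d<N))
    }
    where
    ρ : ℕ → ℕ
    ρ q = vertexAt j (N ∸ q)

    neighbours : ∀ {a q} → 0 < q → q < N → FlowerEdge a (ρ q) → a ≡ ρ (pred q) ⊎ a ≡ ρ (suc q)
    neighbours {q = suc q} 0<q q<N edge
      with interior-neighbours j (m<n⇒0<n∸m q<N) (∸-monoʳ-< 0<q (<⇒≤ q<N)) edge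
    ... | inj₁ a≡ = inj₂ (trans a≡ (cong (vertexAt j) (pred[m∸n]≡m∸[1+n] N (suc q))))
    ... | inj₂ a≡ = inj₁ (trans a≡ (cong (vertexAt j) (suc-mirror (≤-trans (n≤1+n (suc q)) q<N))))

    reflect : ∀ {a b} {σ τ : ℕ → ℕ} →
              (∀ {d} → d < N → σ (N ∸ suc d) ≡ τ (suc d) × σ (suc (N ∸ suc d)) ≡ τ d) →
              (∃ λ d → d < N × SamePair a b (τ d) (τ (suc d))) → ∃ λ d → d < N × SamePair a b (σ d) (σ (suc d))
    reflect σ≡τ (d , d<N , pair) =
      N ∸ suc d , mirror-< d<N ,
      subst₂ (SamePair _ _) (sym (proj₁ (σ≡τ d<N))) (sym (proj₂ (σ≡τ d<N))) (SamePair-flip pair)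

  edge⇒traversal-step : ∀ {a b} → FlowerEdge a b →
                        ∃₂ λ (R : Traversal) k → k < N × a ≡ Traversal.ρ R k × b ≡ Traversal.ρ R (suc k)
  edge⇒traversal-step (j , d , d<N , inj₁ (a≡ , b≡)) = forward j , d , d<N , a≡ , b≡
  edge⇒traversal-step (j , d , d<N , inj₂ (a≡ , b≡)) =
    backward j , N ∸ suc d , mirror-< d<N ,
    trans a≡ (cong (vertexAt j) (sym (proj₁ (mirror-mirror d<N)))) ,
    trans b≡ (cong (vertexAt j) (sym (proj₂ (mirror-mirror d<N))))

  module _ (R : Traversal) where
    open Traversal R

    -- Interior petal vertices have degree two, so a walk that never steps back to the
    -- vertex it just left keeps following the petal.
    follow : (w : ℕ → ℕ) → (∀ i → FlowerEdge (w i) (w (suc i))) → (∀ i → w (suc (suc i)) ≢ w i) →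
             ∀ d {k} → k + d ≤ N → w 0 ≡ ρ k → w 1 ≡ ρ (suc k) → w d ≡ ρ (k + d)
    follow w edge fresh zero          {k} _      w₀ _  = trans w₀ (cong ρ (sym (+-identityʳ k)))
    follow w edge fresh (suc zero)    {k} _      _  w₁ = trans w₁ (cong ρ (+-comm 1 k))
    follow w edge fresh (suc (suc d)) {k} k+d≤N w₀ w₁ =
      trans (follow (w ∘ suc) (edge ∘ suc) (fresh ∘ suc) (suc d) (subst (_≤ N) (+-suc k (suc d)) k+d≤N) w₁ w₂)
            (cong ρ (sym (+-suc k (suc d))))
      where
      1+k<N : suc k < N
      1+k<N = ≤-trans (≤-reflexive (+-comm 2 k)) (≤-trans (+-monoʳ-≤ k (s≤s (s≤s z≤n))) k+d≤N)
      w₂ : w 2 ≡ ρ (suc (suc k))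
      w₂ with ρ-neighbours (s≤s z≤n) 1+k<N (subst (FlowerEdge (w 2)) w₁ (FlowerEdge-sym (edge 1)))
      ... | inj₁ back = contradiction (trans back (sym w₀)) (fresh 0)
      ... | inj₂ on   = on

  module CycleOfFlower (c : Cycle flower) where
    open CycleWalk c

    w : ℕ → ℕ
    w i = toℕ (walk i)

    w-edge : ∀ i → FlowerEdge (w i) (w (suc i))
    w-edge i = adj⇒edge (walk-adj i)

    w-fresh : ∀ i → w (suc (suc i)) ≢ w i
    w-fresh i eq = walk-injective i {2} (s≤s z≤n) (long c) (toℕ-injective eq)

    reaches-hub : ∀ R {k} → k < N → w 0 ≡ Traversal.ρ R k → w 1 ≡ Traversal.ρ R (suc k) → w (N ∸ k) ≡ 0
    reaches-hub R {k} k<N w₀ w₁ = begin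
      w (N ∸ k)       ≡⟨ follow R w w-edge w-fresh (N ∸ k) (≤-reflexive k+[N∸k]≡N) w₀ w₁ ⟩
      ρ (k + (N ∸ k)) ≡⟨ cong ρ k+[N∸k]≡N ⟩
      ρ N             ≡⟨ ρ-N ⟩
      0               ∎
      where
      open Traversal R
      open ≡-Reasoning
      k+[N∸k]≡N : k + (N ∸ k) ≡ N
      k+[N∸k]≡N = m+[n∸m]≡n (<⇒≤ k<N)

    -- Opaque: only the existence of a hub position is used, and unfolding it makes checking
    -- the definitions below very slow.
    opaque
      hub-on-cycle : ∃ λ h → w h ≡ 0
      hub-on-cycle = let (R , k , k<N , w₀ , w₁) = edge⇒traversal-step (w-edge 0) in N ∸ k , reaches-hub R k<N w₀ w₁

    h : ℕ
    h = proj₁ hub-on-cycle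

    leaves-hub : ∀ R {k} → k < N → w h ≡ Traversal.ρ R k → w (suc h) ≡ Traversal.ρ R (suc k) →
                 ∀ d → d ≤ N → w (d + h) ≡ Traversal.ρ R d
    leaves-hub R {zero}  _   w₀ w₁ d d≤N =
      follow R (λ i → w (i + h)) (λ i → w-edge (i + h)) (λ i → w-fresh (i + h)) d d≤N w₀ w₁
    leaves-hub R {suc k} k<N w₀ _ =
      ⊥-elim (Traversal.ρ-interior≢0 R (s≤s z≤n) k<N (trans (sym w₀) (proj₂ hub-on-cycle)))

    anchored : ∃ λ (R : Traversal) → ∀ d → d ≤ N → w (d + h) ≡ Traversal.ρ R d
    anchored = let (R , k , k<N , w₀ , w₁) = edge⇒traversal-step (w-edge h) in R , leaves-hub R k<N w₀ w₁

    open Traversal (proj₁ anchored) public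

    on-petal : ∀ d → d ≤ N → w (d + h) ≡ ρ d
    on-petal = proj₂ anchored

    length≡N : L ≡ N
    length≡N with <-cmp L N
    ... | tri< L<N _ _ = ⊥-elim (ρ-interior≢0 (s≤s z≤n) L<N (begin
      ρ L       ≡⟨ sym (on-petal L (<⇒≤ L<N)) ⟩
      w (L + h) ≡⟨ cong toℕ (walk-periodic h) ⟩
      w h       ≡⟨ on-petal 0 z≤n ⟩
      ρ 0       ≡⟨ ρ-0 ⟩
      0         ∎))
      where open ≡-Reasoning
    ... | tri≈ _ L≡N _ = L≡N
    ... | tri> _ _ N<L = ⊥-elim (walk-injective h 0<N N<L (toℕ-injective (begin
      w (N + h) ≡⟨ on-petal N ≤-refl ⟩
      ρ N       ≡⟨ trans ρ-N (sym ρ-0) ⟩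
      ρ 0       ≡⟨ sym (on-petal 0 z≤n) ⟩
      w h       ∎)))
      where open ≡-Reasoning

    edges : ∀ a b → EdgeOn c a b ⇔ PetalEdge petal (toℕ a) (toℕ b)
    edges a b = mk⇔ to from
      where
      to : EdgeOn c a b → PetalEdge petal (toℕ a) (toℕ b)
      to edgeOn =
        let (i , pair)            = edgeOn⇒walk-edge edgeOn
            (d , d<L , eq₀ , eq₁) = walk-rotate h i
            d<N                   = subst (d <_) length≡N d<L
        in Equivalence.from ρ-edges (d , d<N ,
             subst₂ (SamePair (toℕ a) (toℕ b)) (trans (cong toℕ eq₀) (on-petal d (<⇒≤ d<N)))
                    (trans (cong toℕ eq₁) (on-petal (suc d) d<N)) (SamePair-map toℕ pair))

      from : PetalEdge petal (toℕ a) (toℕ b) → EdgeOn c a b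
      from edge =
        let (d , d<N , pair) = Equivalence.to ρ-edges edge
        in walk-edge⇒edgeOn (d + h) (SamePair-unmap toℕ-injective
             (subst₂ (SamePair (toℕ a) (toℕ b)) (sym (on-petal d (<⇒≤ d<N))) (sym (on-petal (suc d) d<N)) pair))

  -- Opaque for the same reason as hub-on-cycle.
  opaque
    cycle-is-petal : (c : Cycle flower) →
                     ∃ λ j → cycleLength c ≡ N × (∀ a b → EdgeOn c a b ⇔ PetalEdge j (toℕ a) (toℕ b))
    cycle-is-petal c = petal , length≡N , edges
      where open CycleOfFlower c

  flower-cactus : Cactus flower
  flower-cactus c c' x y _ onC onC' a b =
    (λ e → Equivalence.from (E' a b) (subst (λ k → PetalEdge k (toℕ a) (toℕ b)) j≡j' (Equivalence.to (E a b) e))) ,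
    (λ e → Equivalence.from (E a b) (subst (λ k → PetalEdge k (toℕ a) (toℕ b)) (sym j≡j') (Equivalence.to (E' a b) e)))
    where
    j j' : Fin p
    j  = proj₁ (cycle-is-petal c)
    j' = proj₁ (cycle-is-petal c')
    E : ∀ a b → EdgeOn c a b ⇔ PetalEdge j (toℕ a) (toℕ b)
    E = proj₂ (proj₂ (cycle-is-petal c))
    E' : ∀ a b → EdgeOn c' a b ⇔ PetalEdge j' (toℕ a) (toℕ b)
    E' = proj₂ (proj₂ (cycle-is-petal c'))
    j≡j' : j ≡ j'
    j≡j' = let (d , d<N , pair) = Equivalence.to (E x y) onC
               (d' , d'<N , pair') = Equivalence.to (E' x y) onC'
           in proj₁ (petal-edge-unique d<N d'<N pair pair')

  flower-girth : GirthAtLeast flower N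
  flower-girth c = ≤-reflexive (sym (proj₁ (proj₂ (cycle-is-petal c))))

  vertex : Fin p → ℕ → Fin (p * N)
  vertex j d = fromℕ< (vertexAt<pN j d)

  vertex-0 : ∀ j j' → vertex j 0 ≡ vertex j' 0
  vertex-0 j j' = toℕ-injective (trans (toℕ-fromℕ< _) (sym (toℕ-fromℕ< _)))

  vertex-N : ∀ j → vertex j N ≡ vertex j 0
  vertex-N j = toℕ-injective (trans (toℕ-fromℕ< _) (trans (vertexAt-≥N j ≤-refl) (sym (toℕ-fromℕ< _))))

  FlowerArc? : ∀ u v → Dec (FlowerArc u v)
  FlowerArc? u v = Dec.map′ from to
    (any? λ j → any? λ (d : Fin N) → (toℕ u ≟ arcTail j (toℕ d)) ×-dec (toℕ v ≟ arcHead j (toℕ d)))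
    where
    from : (∃₂ λ j (d : Fin N) → toℕ u ≡ arcTail j (toℕ d) × toℕ v ≡ arcHead j (toℕ d)) → FlowerArc u v
    from (j , d , eq₀ , eq₁) = j , toℕ d , toℕ<n d , eq₀ , eq₁
    to : FlowerArc u v → ∃₂ λ j (d : Fin N) → toℕ u ≡ arcTail j (toℕ d) × toℕ v ≡ arcHead j (toℕ d)
    to (j , d , d<N , eq₀ , eq₁) =
      j , fromℕ< d<N , subst (λ x → toℕ u ≡ arcTail j x × toℕ v ≡ arcHead j x) (sym (toℕ-fromℕ< d<N)) (eq₀ , eq₁)

  module _ {k} (R : Fin k → Fin k → Bool) (c : Fin (p * N) → Fin k)
           (preserves : ∀ {u v} → FlowerArc u v → T (R (c u) (c v))) where

    step-along : ∀ j {d} → d < N → T (Along R (orient j d) (c (vertex j d)) (c (vertex j (suc d))))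
    step-along j {d} d<N with orient j d in eq
    ... | true  = preserves (j , d , d<N , trans (toℕ-fromℕ< _) (sym tail≡) , trans (toℕ-fromℕ< _) (sym head≡))
      where
      tail≡ : arcTail j d ≡ vertexAt j d
      tail≡ rewrite eq = refl
      head≡ : arcHead j d ≡ vertexAt j (suc d)
      head≡ rewrite eq = refl
    ... | false = preserves (j , d , d<N , trans (toℕ-fromℕ< _) (sym tail≡) , trans (toℕ-fromℕ< _) (sym head≡))
      where
      tail≡ : arcTail j d ≡ vertexAt j (suc d)
      tail≡ rewrite eq = refl
      head≡ : arcHead j d ≡ vertexAt j d
      head≡ rewrite eq = refl

    petal-walk : ∀ j w → length w ≤ N → (∀ {d} → d < length w → orient j d ≡ bitAt w d) → IsWalk R (c ∘ vertex j) w
    petal-walk j w len≤N orient≡ = IsWalk-bitAt R w (c ∘ vertex j) λ d<len →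
      subst (λ b → T (Along R b _ _)) (orient≡ d<len) (step-along j (<-≤-trans d<len len≤N))

-- The three-petal flower oriented by `petals`

module Construction (k : ℕ) where

  -- Each loop is repeated k + 1 times, so the petals have length 4 + 6 (k + 1) > k.
  N : ℕ
  N = 4 + suc k * 6

  length-petal : ∀ j → length (word (petals j) (suc k)) ≡ N
  length-petal 0F = trans (length-word (petals 0F) (suc k)) (cong (4 +_) (+-identityʳ _))
  length-petal 1F = trans (length-word (petals 1F) (suc k)) (cong (4 +_) (+-identityʳ _))
  length-petal 2F = trans (length-word (petals 2F) (suc k)) (+-comm _ 4)

  open Flower 3 N (s≤s (s≤s (s≤s z≤n))) (λ j → bitAt (word (petals j) (suc k))) public

  N-even : parity N ≡ 0ℙ
  N-even = trans (*-homo-* (suc k) 6) (ℙ-*-zeroʳ (parity (suc k)))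

  no-hom-to-4 : (H : OrientedGraph) → Hom flower H → n H ≤ 4 → ⊥
  no-hom-to-4 H hom n≤4 =
    blocks⇒no-closed-walk (beats tour) {s} {petals j} blocked k (colour ∘ vertex j) walk (cong colour (vertex-0 j 0F)) closes
    where
    colour : Fin (3 * N) → Fin 4
    colour u = inject≤ (proj₁ hom u) n≤4
    extension : ∃ λ tour → ∀ {u v} → FlowerArc u v → T (beats tour (colour u) (colour v))
    extension = hom-to-4-extends-to-tournament flower H FlowerArc? hom n≤4
    tour : Tournament4
    tour = proj₁ extension
    s : Fin 4
    s = colour (vertex 0F 0)
    j : Fin 3
    j = proj₁ (some-petal-blocks tour s)
    blocked : Blocks (beats tour) s (petals j)
    blocked = proj₂ (some-petal-blocks tour s)
    walk : IsWalk (beats tour) (colour ∘ vertex j) (word (petals j) (suc k))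
    walk = petal-walk (beats tour) colour (proj₂ extension) j (word (petals j) (suc k))
                      (≤-reflexive (length-petal j)) (λ _ → refl)
    closes : colour (vertex j (length (word (petals j) (suc k)))) ≡ s
    closes = cong colour (trans (cong (vertex j) (length-petal j)) (trans (vertex-N j) (vertex-0 j 0F)))

  flower-chromatic : OrientedChromaticAtLeast flower 5
  flower-chromatic H hom with 5 ≤? n H
  ... | yes 5≤n = 5≤n
  ... | no  5≰n = ⊥-elim (no-hom-to-4 H hom (≤-pred (≰⇒> 5≰n)))

  flower-girth-≥ : GirthAtLeast flower k
  flower-girth-≥ c = ≤-trans (≤-trans (n≤1+n k) (≤-trans (m≤m*n (suc k) 6) (m≤n+m (suc k * 6) 4))) (flower-girth c)

theorem4p1 : (g : ℕ) → 3 ≤ g →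
    Σ OrientedGraph λ G → Bipartite G × Cactus G × GirthAtLeast G g × OrientedChromaticAtLeast G 5
theorem4p1 g _ = flower , flower-bipartite N-even , flower-cactus , flower-girth-≥ , flower-chromatic
  where open Construction g
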